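{- Let $G$ be a $(2P_3,C_4,C_6)$-free graph, and let $T$ be an induced subgraph of $G$ isomorphic to $T_0$, with vertices labeled $a_0,a_1,b_0,b_1,b_2,b_3,c_1,c_2,c_3$ as in the definition of $T_0$. Then for every $x\in V(G)$, one of the following holds: (a) there exists $v\in V(T)$ such that $N_G[x]\cap V(T)=N_T[v]$; (b) there exists $i\in\{2,3\}$ such that $N_G[x]\cap V(T)=V(T)\setminus\{b_i,c_i\}$; (c) $N_G[x]\cap V(T)=\{c_2,c_3\}$; (d) $N_G[x]\cap V(T)=\emptyset$; (e) $N_G[x]\cap V(T)=V(T)$.
   Context: All graphs are finite, simple and nonnull. $G$ is $H$-free if no induced subgraph is isomorphic to $H$; $C_k$ is the $k$-cycle; $2P_3$ is two disjoint copies of the 3-vertex path. $N[v]$ denotes the closed neighborhood. $T_0$ has vertices $a_0,a_1,b_0,b_1,b_2,b_3,c_1,c_2,c_3$ and edges $a_0a_1$, $a_0b_0,a_0b_2,a_0b_3$, $a_1b_1,a_1b_2,a_1b_3$, $c_1c_2,c_1c_3,c_2c_3$, $c_1b_0,c_1b_1$, $c_2b_2$, $c_3b_3$. -}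

module Defs where

open import Data.Nat using (ℕ)
open import Data.Fin using (Fin; zero; suc; _≟_; #_)
open import Data.Bool using (Bool; true; false; _∨_)
open import Data.Bool.Properties using (∨-comm)
open import Data.Product using (Σ; _×_)
open import Function.Definitions using (Injective)
open import Relation.Binary.PropositionalEquality using (_≡_; refl)
open import Relation.Nullary using (¬_)
open import Relation.Nullary.Decidable using (⌊_⌋)

record Graph : Set where
  field
    n      : ℕ
    adj    : Fin n → Fin n → Bool
    sym    : ∀ u v → adj u v ≡ adj v u
    irrefl : ∀ v → adj v v ≡ false
open Graph public

V : Graph → Set
V G = Fin (n G)

cadj : (G : Graph) → V G → V G → Bool
cadj G x y = ⌊ x ≟ y ⌋ ∨ adj G x y

record InducedCopy (H G : Graph) : Set where
  field
    emb     : V H → V G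
    inj     : Injective _≡_ _≡_ emb
    adj-pres : ∀ i j → adj G (emb i) (emb j) ≡ adj H i j
open InducedCopy public

Free : Graph → Graph → Set
Free H G = ¬ InducedCopy H G

symm : ∀ {k} → (Fin k → Fin k → Bool) → Fin k → Fin k → Bool
symm e i j = e i j ∨ e j i

symm-sym : ∀ {k} (e : Fin k → Fin k → Bool) u v → symm e u v ≡ symm e v u
symm-sym e u v = ∨-comm (e u v) (e v u)

e2P3 : Fin 6 → Fin 6 → Bool
e2P3 zero (suc zero) = true
e2P3 (suc zero) (suc (suc zero)) = true
e2P3 (suc (suc (suc zero))) (suc (suc (suc (suc zero)))) = true
e2P3 (suc (suc (suc (suc zero)))) (suc (suc (suc (suc (suc zero))))) = true
e2P3 _ _ = false

eC4 : Fin 4 → Fin 4 → Bool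
eC4 zero (suc zero) = true
eC4 (suc zero) (suc (suc zero)) = true
eC4 (suc (suc zero)) (suc (suc (suc zero))) = true
eC4 (suc (suc (suc zero))) zero = true
eC4 _ _ = false

eC6 : Fin 6 → Fin 6 → Bool
eC6 zero (suc zero) = true
eC6 (suc zero) (suc (suc zero)) = true
eC6 (suc (suc zero)) (suc (suc (suc zero))) = true
eC6 (suc (suc (suc zero))) (suc (suc (suc (suc zero)))) = true
eC6 (suc (suc (suc (suc zero)))) (suc (suc (suc (suc (suc zero))))) = true
eC6 (suc (suc (suc (suc (suc zero))))) zero = true
eC6 _ _ = false

a₀ a₁ b₀ b₁ b₂ b₃ c₁ c₂ c₃ : Fin 9
a₀ = # 0
a₁ = # 1
b₀ = # 2
b₁ = # 3
b₂ = # 4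
b₃ = # 5
c₁ = # 6
c₂ = # 7
c₃ = # 8

eT0 : Fin 9 → Fin 9 → Bool
eT0 i j = ⌊ i ≟ a₀ ⌋ ∧' (⌊ j ≟ a₁ ⌋ ∨ ⌊ j ≟ b₀ ⌋ ∨ ⌊ j ≟ b₂ ⌋ ∨ ⌊ j ≟ b₃ ⌋)
        ∨ ⌊ i ≟ a₁ ⌋ ∧' (⌊ j ≟ b₁ ⌋ ∨ ⌊ j ≟ b₂ ⌋ ∨ ⌊ j ≟ b₃ ⌋)
        ∨ ⌊ i ≟ c₁ ⌋ ∧' (⌊ j ≟ c₂ ⌋ ∨ ⌊ j ≟ c₃ ⌋ ∨ ⌊ j ≟ b₀ ⌋ ∨ ⌊ j ≟ b₁ ⌋)
        ∨ ⌊ i ≟ c₂ ⌋ ∧' (⌊ j ≟ c₃ ⌋ ∨ ⌊ j ≟ b₂ ⌋)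
        ∨ ⌊ i ≟ c₃ ⌋ ∧' ⌊ j ≟ b₃ ⌋
  where
  _∧'_ : Bool → Bool → Bool
  true ∧' b = b
  false ∧' _ = false
  infixr 7 _∧'_

irr6a : ∀ v → symm e2P3 v v ≡ false
irr6a zero = refl
irr6a (suc zero) = refl
irr6a (suc (suc zero)) = refl
irr6a (suc (suc (suc zero))) = refl
irr6a (suc (suc (suc (suc zero)))) = refl
irr6a (suc (suc (suc (suc (suc zero))))) = refl

irr4 : ∀ v → symm eC4 v v ≡ false
irr4 zero = refl
irr4 (suc zero) = refl
irr4 (suc (suc zero)) = refl
irr4 (suc (suc (suc zero))) = refl

irr6b : ∀ v → symm eC6 v v ≡ false
irr6b zero = refl
irr6b (suc zero) = refl
irr6b (suc (suc zero)) = refl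
irr6b (suc (suc (suc zero))) = refl
irr6b (suc (suc (suc (suc zero)))) = refl
irr6b (suc (suc (suc (suc (suc zero))))) = refl

irr9 : ∀ v → symm eT0 v v ≡ false
irr9 zero = refl
irr9 (suc zero) = refl
irr9 (suc (suc zero)) = refl
irr9 (suc (suc (suc zero))) = refl
irr9 (suc (suc (suc (suc zero)))) = refl
irr9 (suc (suc (suc (suc (suc zero))))) = refl
irr9 (suc (suc (suc (suc (suc (suc zero)))))) = refl
irr9 (suc (suc (suc (suc (suc (suc (suc zero))))))) = refl
irr9 (suc (suc (suc (suc (suc (suc (suc (suc zero)))))))) = refl

2P3 : Graph
2P3 = record { n = 6 ; adj = symm e2P3 ; sym = symm-sym e2P3 ; irrefl = irr6a }

C4 : Graph
C4 = record { n = 4 ; adj = symm eC4 ; sym = symm-sym eC4 ; irrefl = irr4 }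

C6 : Graph
C6 = record { n = 6 ; adj = symm eC6 ; sym = symm-sym eC6 ; irrefl = irr6b }

T0 : Graph
T0 = record { n = 9 ; adj = symm eT0 ; sym = symm-sym eT0 ; irrefl = irr9 }

-- N_G[x] ∩ V(T), pulled back along the labelling T : T0 ↪ G, equals the set S ⊆ V(T0)
NTraceIs : (G : Graph) (T : InducedCopy T0 G) → V G → (Fin 9 → Bool) → Set
NTraceIs G T x S = ∀ i → cadj G x (emb T i) ≡ S i

allBut : Fin 9 → Fin 9 → Fin 9 → Bool
allBut b c j = not' (⌊ j ≟ b ⌋ ∨ ⌊ j ≟ c ⌋)
  where
  not' : Bool → Bool
  not' true = false
  not' false = true

only23 : Fin 9 → Bool
only23 j = ⌊ j ≟ c₂ ⌋ ∨ ⌊ j ≟ c₃ ⌋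

{-# OPTIONS --safe #-}

-- A vertex x of T gives (a) with its own label. Otherwise x is determined, relative to T,
-- by its trace t = N(x) ∩ V(T), one of 2⁹ subsets, and T + x is an induced copy in G of
-- T0 extended by a vertex with neighbourhood t. A finite computation shows that every
-- trace is either one of those listed in (a)–(e) or produces an induced 2P3, C4 or C6 in
-- that extension, which the freeness of G excludes.

module Submission where

open import Defs
open import Data.Bool using (Bool; true; false; T; _∨_)
import Data.Bool.Properties as Bool
open import Data.Empty using (⊥-elim)
open import Data.Fin using (Fin; zero; suc; _≟_)
open import Data.Fin.Properties using (all?; any?)
open import Data.Fin.Subset using (Subset)
open import Data.Fin.Subset.Properties using (anySubset?)
open import Data.List using (List; [_]; concatMap; map; filter; allFin)
import Data.List.Relation.Unary.Any as Any
open import Data.Maybe using (Maybe; is-just; to-witness-T; _<∣>_) renaming (map to mapᵐ)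
open import Data.Nat using (ℕ)
open import Data.Product using (Σ; _×_; _,_; ∃; proj₁; proj₂)
open import Data.Sum using (_⊎_; inj₁; inj₂; [_,_]′) renaming (map to map⊎)
open import Data.Vec using (lookup; tabulate)
open import Data.Vec.Properties using (lookup∘tabulate)
open import Data.Vec.Functional as Vector using (Vector)
open import Function using (_∘_; Injective)
open import Relation.Binary.PropositionalEquality
  using (_≡_; _≢_; _≗_; refl; trans; cong; cong₂) renaming (sym to ≡-sym)
open import Relation.Nullary using (Dec; yes; no; ¬_; ¬?; _×-dec_; _⊎-dec_; _→-dec_)
open import Relation.Nullary.Decidable using (T?; from-no; decidable-stable; dec⇒maybe)

variable
  F G H : Graph

_∘-copy_ : InducedCopy H G → InducedCopy F H → InducedCopy F G
H⊆G ∘-copy F⊆H = record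
  { emb      = emb H⊆G ∘ emb F⊆H
  ; inj      = inj F⊆H ∘ inj H⊆G
  ; adj-pres = λ i j → trans (adj-pres H⊆G _ _) (adj-pres F⊆H i j)
  }

cadj-emb : (T : InducedCopy H G) → ∀ u v → cadj G (emb T u) (emb T v) ≡ cadj H u v
cadj-emb T u v with emb T u ≟ emb T v | u ≟ v
... | yes _    | yes _   = refl
... | no  _    | no  _   = adj-pres T u v
... | yes eu≡ev | no u≢v  = ⊥-elim (u≢v (inj T eu≡ev))
... | no eu≢ev  | yes u≡v = ⊥-elim (eu≢ev (cong (emb T) u≡v))

cadj-≢ : (G : Graph) {x y : V G} → x ≢ y → cadj G x y ≡ adj G x y
cadj-≢ G {x} {y} x≢y with x ≟ y
... | yes x≡y = ⊥-elim (x≢y x≡y)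
... | no  _   = refl

extendAdj : ∀ {k} → (Fin k → Fin k → Bool) → (Fin k → Bool) →
            Fin (ℕ.suc k) → Fin (ℕ.suc k) → Bool
extendAdj a t zero    zero    = false
extendAdj a t zero    (suc j) = t j
extendAdj a t (suc i) zero    = t i
extendAdj a t (suc i) (suc j) = a i j

extend : (H : Graph) → (V H → Bool) → Graph
extend H t = record
  { n = ℕ.suc (n H) ; adj = extendAdj (adj H) t ; sym = extend-sym ; irrefl = extend-irrefl }
  where
  extend-sym : ∀ u v → extendAdj (adj H) t u v ≡ extendAdj (adj H) t v u
  extend-sym zero    zero    = refl
  extend-sym zero    (suc j) = refl
  extend-sym (suc i) zero    = refl
  extend-sym (suc i) (suc j) = sym H i j

  extend-irrefl : ∀ v → extendAdj (adj H) t v v ≡ false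
  extend-irrefl zero    = refl
  extend-irrefl (suc i) = irrefl H i

extend-copy : (T : InducedCopy H G) {x : V G} → (∀ i → x ≢ emb T i) →
              {t : V H → Bool} → (∀ i → adj G x (emb T i) ≡ t i) →
              InducedCopy (extend H t) G
extend-copy {H} {G} T {x} x∉T {t} x-trace = record { emb = ι ; inj = ι-inj ; adj-pres = ι-adj }
  where
  ι : V (extend H t) → V G
  ι zero    = x
  ι (suc i) = emb T i

  ι-inj : Injective _≡_ _≡_ ι
  ι-inj {zero}  {zero}  _ = refl
  ι-inj {zero}  {suc j} e = ⊥-elim (x∉T j e)
  ι-inj {suc i} {zero}  e = ⊥-elim (x∉T i (≡-sym e))
  ι-inj {suc i} {suc j} e = cong suc (inj T e)

  ι-adj : ∀ u v → adj G (ι u) (ι v) ≡ extendAdj (adj H) t u v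
  ι-adj zero    zero    = irrefl G x
  ι-adj zero    (suc j) = x-trace j
  ι-adj (suc i) zero    = trans (sym G (emb T i) x) (x-trace i)
  ι-adj (suc i) (suc j) = adj-pres T i j

IsInducedEmbedding : (F H : Graph) → (V F → V H) → Set
IsInducedEmbedding F H f = ∀ i j → (f i ≡ f j → i ≡ j) × adj H (f i) (f j) ≡ adj F i j

isInducedEmbedding? : ∀ F H f → Dec (IsInducedEmbedding F H f)
isInducedEmbedding? F H f = all? λ i → all? λ j →
  (f i ≟ f j →-dec i ≟ j) ×-dec (adj H (f i) (f j) Bool.≟ adj F i j)

embedding⇒copy : {f : V F → V H} → IsInducedEmbedding F H f → InducedCopy F H
embedding⇒copy {f = f} e = record
  { emb = f ; inj = λ {i} {j} → proj₁ (e i j) ; adj-pres = λ i j → proj₂ (e i j) }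

-- Extends partial maps vertex by vertex, from the last vertex of F down, keeping only those
-- that are injective and preserve adjacency and non-adjacency. The list is not proved
-- correct: findCopy rechecks the map it returns.
inducedEmbeddings : ∀ {k m} → (Fin k → Fin k → Bool) → (Fin m → Fin m → Bool) →
                    List (Vector (Fin m) k)
inducedEmbeddings {ℕ.zero} a b = [ Vector.[] ]
inducedEmbeddings {ℕ.suc k} {m} a b =
  concatMap extensions (inducedEmbeddings (λ i j → a (suc i) (suc j)) b)
  where
  extensions : Vector (Fin m) k → List (Vector (Fin m) (ℕ.suc k))
  extensions f = map (Vector._∷ f) (filter (λ v → all? λ j →
    ¬? (v ≟ f j) ×-dec (b v (f j) Bool.≟ a zero (suc j))) (allFin m))

findCopy : (F H : Graph) → Maybe (InducedCopy F H)
findCopy F H = mapᵐ (embedding⇒copy ∘ proj₂ ∘ Any.satisfied)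
  (dec⇒maybe (Any.any? (isInducedEmbedding? F H) (inducedEmbeddings (adj F) (adj H))))

HasForbiddenCopy : Graph → Set
HasForbiddenCopy H = InducedCopy 2P3 H ⊎ InducedCopy C4 H ⊎ InducedCopy C6 H

forbidden-free : Free 2P3 G → Free C4 G → Free C6 G → InducedCopy H G → ¬ HasForbiddenCopy H
forbidden-free 2P3-free C4-free C6-free H⊆G =
  [ 2P3-free ∘ (H⊆G ∘-copy_) , [ C4-free ∘ (H⊆G ∘-copy_) , C6-free ∘ (H⊆G ∘-copy_) ]′ ]′

-- The order of the searches affects only the running time of every-trace-classified.
findForbiddenCopy : (H : Graph) → Maybe (HasForbiddenCopy H)
findForbiddenCopy H = mapᵐ (inj₂ ∘ inj₁) (findCopy C4 H)
  <∣> mapᵐ inj₁ (findCopy 2P3 H)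
  <∣> mapᵐ (inj₂ ∘ inj₂) (findCopy C6 H)

Outcome : ((Fin 9 → Bool) → Set) → Set
Outcome Holds =
  Σ (Fin 9) (λ v → Holds (cadj T0 v))
  ⊎ (Holds (allBut b₂ c₂) ⊎ Holds (allBut b₃ c₃))
  ⊎ Holds only23
  ⊎ Holds (λ _ → false)
  ⊎ Holds (λ _ → true)

Outcome-map : {P Q : (Fin 9 → Bool) → Set} → (∀ {S} → P S → Q S) → Outcome P → Outcome Q
Outcome-map f = map⊎ (λ (v , p) → v , f p) (map⊎ (map⊎ f f) (map⊎ f (map⊎ f f)))

outcome? : {Holds : (Fin 9 → Bool) → Set} → (∀ S → Dec (Holds S)) → Dec (Outcome Holds)
outcome? holds? = any? (holds? ∘ cadj T0) ⊎-dec (holds? _ ⊎-dec holds? _)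
  ⊎-dec holds? _ ⊎-dec holds? _ ⊎-dec holds? _

Classified : (Fin 9 → Bool) → Set
Classified t = Outcome (t ≗_) ⊎ HasForbiddenCopy (extend T0 t)

classify : (t : Fin 9 → Bool) → Maybe (Classified t)
classify t = mapᵐ inj₁ (dec⇒maybe (outcome? λ S → all? λ i → t i Bool.≟ S i))
  <∣> mapᵐ inj₂ (findForbiddenCopy (extend T0 t))

every-trace-classified : (s : Subset 9) → T (is-just (classify (lookup s)))
every-trace-classified s =
  decidable-stable (T? _) λ ¬classified → from-no unclassified? (s , ¬classified)
  where
  unclassified? : Dec (∃ λ (s : Subset 9) → ¬ T (is-just (classify (lookup s))))
  unclassified? = anySubset? λ s → ¬? (T? _)

lemma4p2 : (G : Graph) → Free 2P3 G → Free C4 G → Free C6 G →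
    (T : InducedCopy T0 G) → (x : V G) →
      Σ (Fin 9) (λ v → NTraceIs G T x (cadj T0 v))
      ⊎ (NTraceIs G T x (allBut b₂ c₂) ⊎ NTraceIs G T x (allBut b₃ c₃))
      ⊎ NTraceIs G T x only23
      ⊎ NTraceIs G T x (λ _ → false)
      ⊎ NTraceIs G T x (λ _ → true)
lemma4p2 G 2P3-free C4-free C6-free T x with any? (λ v → x ≟ emb T v)
... | yes (v , refl) = inj₁ (v , cadj-emb T v)
... | no x∈T⇒⊥ =
  [ Outcome-map {P = t ≗_} (λ t≗S i → trans (closed-trace i) (t≗S i))
  , ⊥-elim ∘ forbidden-free 2P3-free C4-free C6-free (extend-copy T x∉T open-trace)
  ]′ (to-witness-T (classify t) (every-trace-classified s))
  where
  s : Subset 9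
  s = tabulate λ i → adj G x (emb T i)
  t : Fin 9 → Bool
  t = lookup s
  x∉T : ∀ i → x ≢ emb T i
  x∉T i = x∈T⇒⊥ ∘ (i ,_)
  open-trace : ∀ i → adj G x (emb T i) ≡ t i
  open-trace i = ≡-sym (lookup∘tabulate (λ j → adj G x (emb T j)) i)
  closed-trace : ∀ i → cadj G x (emb T i) ≡ t i
  closed-trace i = trans (cadj-≢ G (x∉T i)) (open-trace i)
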